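{- Let $F$ be a formula schema containing no formula variables and let $\sigma$ be a parameter assignment. Then $\sigma(F){\downarrow_o}$ is an ordinary quantifier-free first-order formula, i.e. it contains no defined predicate or function symbols and no parameters.
   Context: Setting: $\omega$-terms are built from $\bar 0$, $s$, parameters (variables of sort $\omega$) and primitive-recursively defined numeric function symbols; a parameter assignment $\sigma$ maps parameters to numerals and $\sigma(t){\downarrow_\omega}$ is the numeral normal form of $\sigma(t)$. Schematic $\iota$-terms are built from constants, V-terms $X(t_1,\dots,t_\gamma)$ ($X$ a global variable of type $\omega^\gamma\to\iota$, $t_i$ $\omega$-terms), ordinary function symbols and primitive-recursively defined $\iota$-function symbols; $\sigma(t){\downarrow_\iota}$ is the evaluation of such a term, an ordinary first-order term with no defined symbols and no parameters (its variables are V-terms with numeral arguments). Formula schemata: formula variables $\xi$ (of type $o$); atoms $P(t_1,\dots,t_\alpha)$ for ordinary predicate symbols $P\colon\iota^\alpha\to o$ and $\iota$-terms $t_i$; $\hat P(X_1,\dots,X_\alpha,t_1,\dots,t_{\beta+1})$ for defined predicate symbols $\hat P$ of type $(\omega^{\gamma_1}\to\iota)\times\dots\times(\omega^{\gamma_\alpha}\to\iota)\times\omega^{\beta+1}\to o$, global variables $X_i$ and $\omega$-terms $t_j$; and closure under $\neg,\wedge,\vee$. Defined predicate symbols are partially ordered by an irreflexive, transitive, Noetherian order $<$, and each $\hat P$ has defining equations $\hat P(\vec X,n_1,\dots,n_\beta,\bar 0)=F_B$, $\hat P(\vec X,n_1,\dots,n_\beta,s(m))=F_S\{\xi\leftarrow\hat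 P(\vec X,n_1,\dots,n_\beta,m)\}$, where $F_B,F_S$ are formula schemata whose global variables are among $\vec X$, whose parameters are among $\vec n$ (and $m$ for $F_S$), $F_S$ may contain the formula variable $\xi$, and every defined predicate symbol occurring in $F_B,F_S$ is $<\hat P$ (none if $\hat P$ is minimal). Evaluation $\sigma(F){\downarrow_o}$: $\sigma(\xi){\downarrow_o}=\xi$; $\sigma(P(t_1,\dots,t_\alpha)){\downarrow_o}=P(\sigma(t_1){\downarrow_\iota},\dots,\sigma(t_\alpha){\downarrow_\iota})$; for $\hat P(\vec X,\vec t,t_{\beta+1})$: if $\sigma(t_{\beta+1}){\downarrow_\omega}=\bar 0$ the value is $\sigma(F_B){\downarrow_o}$ (with $\vec n$ instantiated by $\vec t$), and if $\sigma(t_{\beta+1}){\downarrow_\omega}=s(\bar p)$ the value is $\sigma(F_S\{\xi\leftarrow\hat P(\vec X,\vec t,\bar p)\}){\downarrow_o}$; $\sigma(\neg F){\downarrow_o}=\neg\sigma(F){\downarrow_o}$; $\sigma(F_1\circ F_2){\downarrow_o}=\sigma(F_1){\downarrow_o}\circ\sigma(F_2){\downarrow_o}$ for $\circ\in\{\wedge,\vee\}$. -}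

module Defs where

open import Data.Nat using (ℕ; zero; suc)
open import Data.Fin using (Fin; zero; suc)
open import Data.Vec using (Vec; []; _∷_; lookup)
open import Data.Vec.Relation.Unary.All using (All)
open import Data.Product using (Σ; _,_; ∃; _×_)
open import Relation.Binary.PropositionalEquality using (_≡_; subst)
open import Relation.Nullary using (¬_)
open import Induction.WellFounded using (WellFounded)

-- Signature of the schematic language.
--  * NFun : primitive-recursively defined numeric (ω-)function symbols,
--           with arity nar and their value function nsem
--           (σ(t)↓ω is the numeral of the computed value).
--  * Const, Fun : ordinary constants and function symbols of sort ι.
--  * IDFun : primitive-recursively defined ι-function symbols h,
--           taking hα global variables (the i-th of type ω^(hγ h i) → ι)
--           and hβ ω-arguments.
--  * Pred : ordinary predicate symbols P : ι^(par P) → o.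
--  * DPred : defined predicate symbols P̂, taking dα global variables
--           (the i-th of type ω^(dγ P i) → ι) and dβ + 1 ω-arguments.
record Sig : Set₁ where
  field
    NFun  : Set
    nar   : NFun → ℕ
    nsem  : (f : NFun) → Vec ℕ (nar f) → ℕ
    Const : Set
    Fun   : Set
    far   : Fun → ℕ
    IDFun : Set
    hα    : IDFun → ℕ
    hγ    : (h : IDFun) → Fin (hα h) → ℕ
    hβ    : IDFun → ℕ
    Pred  : Set
    par   : Pred → ℕ
    DPred : Set
    dα    : DPred → ℕ
    dγ    : (P : DPred) → Fin (dα P) → ℕ
    dβ    : DPred → ℕ

-- Top-level global variables of type ω^γ → ι are named by natural numbers.
GN : ℕ → Set
GN γ = ℕ

module Schema (S : Sig) where
  open Sig S

  -- formal global-variable slots of a defined ι-function / predicate symbol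
  HSlot : IDFun → ℕ → Set
  HSlot h γ = Σ (Fin (hα h)) (λ i → hγ h i ≡ γ)

  DSlot : DPred → ℕ → Set
  DSlot P γ = Σ (Fin (dα P)) (λ i → dγ P i ≡ γ)

  data ΩTerm (V : Set) : Set where
    ω0   : ΩTerm V
    ωs   : ΩTerm V → ΩTerm V
    ωpar : V → ΩTerm V
    ωapp : (f : NFun) → Vec (ΩTerm V) (nar f) → ΩTerm V

  numeral : ∀ {V} → ℕ → ΩTerm V
  numeral zero    = ω0
  numeral (suc n) = ωs (numeral n)

  mutual
    evalΩ : ∀ {V} → (V → ℕ) → ΩTerm V → ℕ
    evalΩ σ ω0         = zero
    evalΩ σ (ωs t)     = suc (evalΩ σ t)
    evalΩ σ (ωpar x)   = σ x
    evalΩ σ (ωapp f ts) = nsem f (evalΩs σ ts)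

    evalΩs : ∀ {V n} → (V → ℕ) → Vec (ΩTerm V) n → Vec ℕ n
    evalΩs σ []       = []
    evalΩs σ (t ∷ ts) = evalΩ σ t ∷ evalΩs σ ts

  mutual
    substΩ : ∀ {V W} → (V → ΩTerm W) → ΩTerm V → ΩTerm W
    substΩ θ ω0          = ω0
    substΩ θ (ωs t)      = ωs (substΩ θ t)
    substΩ θ (ωpar x)    = θ x
    substΩ θ (ωapp f ts) = ωapp f (substΩs θ ts)

    substΩs : ∀ {V W n} → (V → ΩTerm W) → Vec (ΩTerm V) n → Vec (ΩTerm W) n
    substΩs θ []       = []
    substΩs θ (t ∷ ts) = substΩ θ t ∷ substΩs θ ts

  -- ordinary first-order ι-terms: variables are V-terms with numeral arguments
  data OTerm (G : ℕ → Set) : Set where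
    ovar   : ∀ {γ} → G γ → Vec ℕ γ → OTerm G
    oconst : Const → OTerm G
    oapp   : (g : Fun) → Vec (OTerm G) (far g) → OTerm G

  mutual
    renO : ∀ {G H : ℕ → Set} → (∀ {γ} → G γ → H γ) → OTerm G → OTerm H
    renO ρ (ovar X ns)  = ovar (ρ X) ns
    renO ρ (oconst c)   = oconst c
    renO ρ (oapp g ts)  = oapp g (renOs ρ ts)

    renOs : ∀ {G H : ℕ → Set} {n} → (∀ {γ} → G γ → H γ) → Vec (OTerm G) n → Vec (OTerm H) n
    renOs ρ []       = []
    renOs ρ (t ∷ ts) = renO ρ t ∷ renOs ρ ts

  data ITerm (G : ℕ → Set) (V : Set) : Set where
    vterm  : ∀ {γ} → G γ → Vec (ΩTerm V) γ → ITerm G V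
    iconst : Const → ITerm G V
    iapp   : (g : Fun) → Vec (ITerm G V) (far g) → ITerm G V
    idef   : (h : IDFun) → ((i : Fin (hα h)) → G (hγ h i)) → Vec (ΩTerm V) (hβ h) → ITerm G V

  -- evaluation of defined ι-function symbols: for numeral arguments, the
  -- (ordinary) value term over the formal global-variable slots
  record IFunDefs : Set where
    field
      hsem : (h : IDFun) → Vec ℕ (hβ h) → OTerm (HSlot h)

  mutual
    substI : ∀ {G H : ℕ → Set} {V W} → (∀ {γ} → G γ → H γ) → (V → ΩTerm W) → ITerm G V → ITerm H W
    substI ρ θ (vterm X ts)   = vterm (ρ X) (substΩs θ ts)
    substI ρ θ (iconst c)     = iconst c
    substI ρ θ (iapp g ts)    = iapp g (substIs ρ θ ts)
    substI ρ θ (idef h Xs ts) = idef h (λ i → ρ (Xs i)) (substΩs θ ts)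

    substIs : ∀ {G H : ℕ → Set} {V W n} → (∀ {γ} → G γ → H γ) → (V → ΩTerm W) → Vec (ITerm G V) n → Vec (ITerm H W) n
    substIs ρ θ []       = []
    substIs ρ θ (t ∷ ts) = substI ρ θ t ∷ substIs ρ θ ts

  infix 30 ¬'_
  infixr 25 _∧'_ _∨'_
  data Formula (G : ℕ → Set) (V : Set) : Set where
    ξ     : Formula G V
    atom  : (P : Pred) → Vec (ITerm G V) (par P) → Formula G V
    dpred : (P : DPred) → ((i : Fin (dα P)) → G (dγ P i)) → Vec (ΩTerm V) (dβ P) → ΩTerm V → Formula G V
    ¬'_   : Formula G V → Formula G V
    _∧'_  : Formula G V → Formula G V → Formula G V
    _∨'_  : Formula G V → Formula G V → Formula G V

  substF : ∀ {G H : ℕ → Set} {V W} → (∀ {γ} → G γ → H γ) → (V → ΩTerm W) → Formula H W → Formula G V → Formula H W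
  substF ρ θ φ ξ                 = φ
  substF ρ θ φ (atom P ts)       = atom P (substIs ρ θ ts)
  substF ρ θ φ (dpred P Xs ts t) = dpred P (λ i → ρ (Xs i)) (substΩs θ ts) (substΩ θ t)
  substF ρ θ φ (¬' F)            = ¬' substF ρ θ φ F
  substF ρ θ φ (F ∧' G)          = substF ρ θ φ F ∧' substF ρ θ φ G
  substF ρ θ φ (F ∨' G)          = substF ρ θ φ F ∨' substF ρ θ φ G

  data NoFVar {G V} : Formula G V → Set where
    nf-atom  : ∀ {P ts} → NoFVar (atom P ts)
    nf-dpred : ∀ {P Xs ts t} → NoFVar (dpred P Xs ts t)
    nf-¬     : ∀ {F} → NoFVar F → NoFVar (¬' F)
    nf-∧     : ∀ {F F'} → NoFVar F → NoFVar F' → NoFVar (F ∧' F')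
    nf-∨     : ∀ {F F'} → NoFVar F → NoFVar F' → NoFVar (F ∨' F')

  data DPredsIn {G V} (Q : DPred → Set) : Formula G V → Set where
    dp-ξ     : DPredsIn Q ξ
    dp-atom  : ∀ {P ts} → DPredsIn Q (atom P ts)
    dp-dpred : ∀ {P Xs ts t} → Q P → DPredsIn Q (dpred P Xs ts t)
    dp-¬     : ∀ {F} → DPredsIn Q F → DPredsIn Q (¬' F)
    dp-∧     : ∀ {F F'} → DPredsIn Q F → DPredsIn Q F' → DPredsIn Q (F ∧' F')
    dp-∨     : ∀ {F F'} → DPredsIn Q F → DPredsIn Q F' → DPredsIn Q (F ∨' F')

  -- Defining equations of the defined predicate symbols.
  -- base P is F_B with parameters n_1..n_β as Fin β (n_{i+1} = index i);
  -- step P is F_S with parameters Fin (suc β): index zero is m,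
  -- index (suc i) is n_{i+1}.  Global variables range over the formal slots.
  record PredDefs : Set₁ where
    field
      _≺_        : DPred → DPred → Set
      ≺-irrefl   : ∀ {P} → ¬ (P ≺ P)
      ≺-trans    : ∀ {P Q R} → P ≺ Q → Q ≺ R → P ≺ R
      ≺-wf       : WellFounded _≺_
      base       : (P : DPred) → Formula (DSlot P) (Fin (dβ P))
      step       : (P : DPred) → Formula (DSlot P) (Fin (suc (dβ P)))
      base-noξ   : ∀ P → NoFVar (base P)
      base-below : ∀ P → DPredsIn (λ Q → Q ≺ P) (base P)
      step-below : ∀ P → DPredsIn (λ Q → Q ≺ P) (step P)

  module Eval (I : IFunDefs) (D : PredDefs) where
    open IFunDefs I
    open PredDefs D

    mutual
      embed : ∀ {G V} → OTerm G → ITerm G V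
      embed (ovar X ns) = vterm X (numerals ns)
      embed (oconst c)  = iconst c
      embed (oapp g ts) = iapp g (embeds ts)

      embeds : ∀ {G V n} → Vec (OTerm G) n → Vec (ITerm G V) n
      embeds []       = []
      embeds (t ∷ ts) = embed t ∷ embeds ts

      numerals : ∀ {V n} → Vec ℕ n → Vec (ΩTerm V) n
      numerals []       = []
      numerals (k ∷ ks) = numeral k ∷ numerals ks

    slotH : ∀ {G : ℕ → Set} (h : IDFun) → ((i : Fin (hα h)) → G (hγ h i)) → ∀ {γ} → HSlot h γ → G γ
    slotH {G} h Xs (i , eq) = subst G eq (Xs i)

    slotD : ∀ {G : ℕ → Set} (P : DPred) → ((i : Fin (dα P)) → G (dγ P i)) → ∀ {γ} → DSlot P γ → G γ
    slotD {G} P Xs (i , eq) = subst G eq (Xs i)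

    mutual
      evalI : ∀ {G V} → (V → ℕ) → ITerm G V → OTerm G
      evalI σ (vterm X ts)   = ovar X (evalΩs σ ts)
      evalI σ (iconst c)     = oconst c
      evalI σ (iapp g ts)    = oapp g (evalIs σ ts)
      evalI σ (idef h Xs ts) = renO (slotH h Xs) (hsem h (evalΩs σ ts))

      evalIs : ∀ {G V n} → (V → ℕ) → Vec (ITerm G V) n → Vec (OTerm G) n
      evalIs σ []       = []
      evalIs σ (t ∷ ts) = evalI σ t ∷ evalIs σ ts

    θB : ∀ {β} → Vec (ΩTerm ℕ) β → Fin β → ΩTerm ℕ
    θB ts i = lookup ts i

    θS : ∀ {β} → Vec (ΩTerm ℕ) β → ℕ → Fin (suc β) → ΩTerm ℕ
    θS ts p zero    = numeral p
    θS ts p (suc i) = lookup ts i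

    -- σ ⊢ F ⇓ R  :  σ(F)↓o = R
    infix 10 _⊢_⇓_
    data _⊢_⇓_ (σ : ℕ → ℕ) : Formula GN ℕ → Formula GN ℕ → Set where
      e-ξ    : σ ⊢ ξ ⇓ ξ
      e-atom : ∀ {P ts} → σ ⊢ atom P ts ⇓ atom P (embeds (evalIs σ ts))
      e-base : ∀ {P Xs ts t R} → evalΩ σ t ≡ zero →
               σ ⊢ substF (slotD P Xs) (θB ts) ξ (base P) ⇓ R →
               σ ⊢ dpred P Xs ts t ⇓ R
      e-step : ∀ {P Xs ts t p R} → evalΩ σ t ≡ suc p →
               σ ⊢ substF (slotD P Xs) (θS ts p) (dpred P Xs ts (numeral p)) (step P) ⇓ R →
               σ ⊢ dpred P Xs ts t ⇓ R
      e-¬    : ∀ {F R} → σ ⊢ F ⇓ R → σ ⊢ ¬' F ⇓ ¬' R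
      e-∧    : ∀ {F F' R R'} → σ ⊢ F ⇓ R → σ ⊢ F' ⇓ R' → σ ⊢ F ∧' F' ⇓ R ∧' R'
      e-∨    : ∀ {F F' R R'} → σ ⊢ F ⇓ R → σ ⊢ F' ⇓ R' → σ ⊢ F ∨' F' ⇓ R ∨' R'

  data IsNumeral {V} : ΩTerm V → Set where
    num0 : IsNumeral ω0
    numS : ∀ {t} → IsNumeral t → IsNumeral (ωs t)

  data OrdTerm {G V} : ITerm G V → Set where
    ot-var   : ∀ {γ} {X : G γ} {ts} → All IsNumeral ts → OrdTerm (vterm X ts)
    ot-const : ∀ {c} → OrdTerm (iconst c)
    ot-app   : ∀ {g ts} → All OrdTerm ts → OrdTerm (iapp g ts)

  data Ordinary {G V} : Formula G V → Set where
    or-atom : ∀ {P ts} → All OrdTerm ts → Ordinary (atom P ts)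
    or-¬    : ∀ {F} → Ordinary F → Ordinary (¬' F)
    or-∧    : ∀ {F F'} → Ordinary F → Ordinary F' → Ordinary (F ∧' F')
    or-∨    : ∀ {F F'} → Ordinary F → Ordinary F' → Ordinary (F ∨' F')

-- Call a schema F "good" if σ(F)↓o exists and is ordinary.  Goodness is closed
-- under ¬, ∧, ∨, and atoms are good because σ(t)↓ι is an ordinary term with
-- numeral arguments.  The only difficult case is a defined predicate
-- P̂(X⃗, t⃗, t), handled by well-founded induction on P̂ along ≺ and, inside it,
-- by induction on the value n of σ(t):
--  * n = 0: the instantiated base F_B contains no ξ and only symbols ≺ P̂;
--  * n = p+1: the instantiated step F_S contains only symbols ≺ P̂, and ξ is
--    replaced by P̂(X⃗, t⃗, p̄), which is good by the inner induction hypothesis.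
-- Both cases are instances of two substitution lemmas: an instantiated schema
-- whose defined predicates are all ≺ P̂ is good, provided either it has no
-- formula variable or the formula substituted for ξ is good.

module Submission where

open import Defs
open import Data.Nat using (ℕ; zero; suc)
open import Data.Vec using (Vec; []; _∷_)
open import Data.Vec.Relation.Unary.All using (All; []; _∷_)
open import Data.Product using (∃; _×_; _,_)
open import Relation.Binary.PropositionalEquality using (_≡_; refl; cong)
open import Induction.WellFounded using (Acc; acc)

module Proof (S : Sig) (I : Schema.IFunDefs S) (D : Schema.PredDefs S) (σ : ℕ → ℕ) where
  open Sig S
  open Schema S
  open Eval I D
  open PredDefs D

  Good : Formula GN ℕ → Set
  Good F = ∃ λ R → σ ⊢ F ⇓ R × Ordinary R

  good-¬ : ∀ {F} → Good F → Good (¬' F)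
  good-¬ (R , e , o) = ¬' R , e-¬ e , or-¬ o

  good-∧ : ∀ {F F'} → Good F → Good F' → Good (F ∧' F')
  good-∧ (R , e , o) (R' , e' , o') = R ∧' R' , e-∧ e e' , or-∧ o o'

  good-∨ : ∀ {F F'} → Good F → Good F' → Good (F ∨' F')
  good-∨ (R , e , o) (R' , e' , o') = R ∨' R' , e-∨ e e' , or-∨ o o'

  evalΩ-numeral : ∀ {V} (τ : V → ℕ) k → evalΩ τ (numeral k) ≡ k
  evalΩ-numeral τ zero    = refl
  evalΩ-numeral τ (suc k) = cong suc (evalΩ-numeral τ k)

  numeral-isNumeral : ∀ {V} k → IsNumeral {V} (numeral k)
  numeral-isNumeral zero    = num0
  numeral-isNumeral (suc k) = numS (numeral-isNumeral k)

  mutual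
    embed-ordinary : ∀ {G V} (t : OTerm G) → OrdTerm {G} {V} (embed t)
    embed-ordinary (ovar X ns) = ot-var (numerals-isNumeral ns)
    embed-ordinary (oconst c)  = ot-const
    embed-ordinary (oapp g ts) = ot-app (embeds-ordinary ts)

    embeds-ordinary : ∀ {G V n} (ts : Vec (OTerm G) n) → All (OrdTerm {G} {V}) (embeds ts)
    embeds-ordinary []       = []
    embeds-ordinary (t ∷ ts) = embed-ordinary t ∷ embeds-ordinary ts

    numerals-isNumeral : ∀ {V n} (ks : Vec ℕ n) → All (IsNumeral {V}) (numerals ks)
    numerals-isNumeral []       = []
    numerals-isNumeral (k ∷ ks) = numeral-isNumeral k ∷ numerals-isNumeral ks

  good-atom : ∀ P ts → Good (atom P ts)
  good-atom P ts = _ , e-atom , or-atom (embeds-ordinary (evalIs σ ts))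

  -- Substitution lemmas for a defining equation of P̂: all predicates in the
  -- schema are ≺ P̂ and assumed good (outer induction hypothesis).
  module Instantiate (P : DPred)
                     (below-good : ∀ {Q} → Q ≺ P → ∀ Xs ts t → Good (dpred Q Xs ts t))
                     {G : ℕ → Set} {V : Set}
                     (ρ : ∀ {γ} → G γ → GN γ) (θ : V → ΩTerm ℕ) (φ : Formula GN ℕ) where

    instantiate-noξ : (F : Formula G V) → NoFVar F → DPredsIn (λ Q → Q ≺ P) F →
                      Good (substF ρ θ φ F)
    instantiate-noξ (atom Q ts)       _            _             = good-atom Q _
    instantiate-noξ (dpred Q Xs ts t) _            (dp-dpred q)  = below-good q _ _ _
    instantiate-noξ (¬' F)            (nf-¬ n)     (dp-¬ d)      = good-¬ (instantiate-noξ F n d)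
    instantiate-noξ (F ∧' F')         (nf-∧ n n')  (dp-∧ d d')   =
      good-∧ (instantiate-noξ F n d) (instantiate-noξ F' n' d')
    instantiate-noξ (F ∨' F')         (nf-∨ n n')  (dp-∨ d d')   =
      good-∨ (instantiate-noξ F n d) (instantiate-noξ F' n' d')

    instantiate : Good φ → (F : Formula G V) → DPredsIn (λ Q → Q ≺ P) F →
                  Good (substF ρ θ φ F)
    instantiate gφ ξ                 _            = gφ
    instantiate gφ (atom Q ts)       _            = good-atom Q _
    instantiate gφ (dpred Q Xs ts t) (dp-dpred q) = below-good q _ _ _
    instantiate gφ (¬' F)            (dp-¬ d)     = good-¬ (instantiate gφ F d)
    instantiate gφ (F ∧' F')         (dp-∧ d d')  = good-∧ (instantiate gφ F d) (instantiate gφ F' d')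
    instantiate gφ (F ∨' F')         (dp-∨ d d')  = good-∨ (instantiate gφ F d) (instantiate gφ F' d')

  good-dpred : ∀ P → Acc _≺_ P → ∀ Xs ts t → Good (dpred P Xs ts t)
  good-dpred P (acc below) Xs ts t = by-value (evalΩ σ t) t refl
    where
    open Instantiate P (λ q → good-dpred _ (below q))

    by-value : ∀ n t → evalΩ σ t ≡ n → Good (dpred P Xs ts t)
    by-value zero t eq with instantiate-noξ (slotD P Xs) (θB ts) ξ (base P) (base-noξ P) (base-below P)
    ... | R , e , o = R , e-base eq e , o
    by-value (suc p) t eq
      with instantiate (slotD P Xs) (θS ts p) (dpred P Xs ts (numeral p))
                       (by-value p (numeral p) (evalΩ-numeral σ p)) (step P) (step-below P)
    ... | R , e , o = R , e-step eq e , o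

  good : (F : Formula GN ℕ) → NoFVar F → Good F
  good (atom P ts)       _            = good-atom P ts
  good (dpred P Xs ts t) _            = good-dpred P (≺-wf P) Xs ts t
  good (¬' F)            (nf-¬ n)     = good-¬ (good F n)
  good (F ∧' F')         (nf-∧ n n')  = good-∧ (good F n) (good F' n')
  good (F ∨' F')         (nf-∨ n n')  = good-∨ (good F n) (good F' n')

proposition9 : (S : Sig) (I : Schema.IFunDefs S) (D : Schema.PredDefs S)
    (F : Schema.Formula S GN ℕ) → Schema.NoFVar S F → (σ : ℕ → ℕ) →
    ∃ λ R → Schema.Eval._⊢_⇓_ S I D σ F R × Schema.Ordinary S R
proposition9 S I D F noξ σ = Proof.good S I D σ F noξ
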